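{- For positive integers $n$ and $r$ with $r \geq 2$, let $(A,B,C)$ be a sequence of distinct elements of $F_r(n)$. If $r \geq 3$: if $\gamma(A,B) \not\equiv_{r-1} \gamma(B,C)$ then $\gamma(A,C) = \min_{\prec_{r-1}}\{\gamma(A,B),\gamma(B,C)\}$, and otherwise $\gamma(A,B)\prec_{r-1}\gamma(A,C)$ and $\gamma(B,C) \prec_{r-1} \gamma(A,C)$. If $r=2$: if $\gamma(A,B) \neq \gamma(B,C)$ then $\gamma(A,C) \in \{\gamma(A,B),\gamma(B,C)\}$, and otherwise $\gamma(A,C) =\gamma(A,B) = \gamma(B,C)$.
   Context: Fix a positive integer $n$. Level 1: $F_1(n)=\{ -,+\}$ with $F_1^-(n)=\{ -\}$, $F_1^+(n)=\{+\}$, $-<_1+$, $-\equiv_1+$. Level 2: $F_2^-(n)=\{(2n-i+1,i): i\in[n]\}$, $F_2^+(n)=\{(i,2n-i+1): i\in[n]\}$, $F_2(n)=F_2^-(n)\cup F_2^+(n)$, ordered $(2n,1)<_2(2n-1,2)<_2\dots<_2(1,2n)$, with $(2n-i+1,i)\equiv_2(i,2n-i+1)$. For $r\ge2$, each $\equiv_r$-class contains exactly one element of $F_r^-(n)$; for $A\in F_r(n)$ let $A^-$ be that element for the class of $A$, and define $A\preceq_r B$ iff $A^-\le_r B^-$ and $A\prec_r B$ iff $A^-<_r B^-$ (a linear order on $\equiv_r$-classes; equivalent elements are equal in $\preceq_r$). For distinct $A=(a_1,a_2),B=(b_1,b_2)\in F_2(n)$, $\gamma(A,B)=-$ if $a_1<b_1$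 and $+$ if $a_1>b_1$. For $r\ge3$: $F_r(n)$ is the family of sets $X\subseteq F_{r-1}(n)$ containing exactly one element of each $\equiv_{r-1}$-class; $F_r^-(n)$ ($F_r^+(n)$) consists of those containing the $<_{r-1}$-minimum (maximum) of $F_{r-1}(n)$. For distinct $A,B\in F_r(n)$, $\gamma(A,B)$ is the element of $B\cap E$, where $E$ is the $\prec_{r-1}$-first $\equiv_{r-1}$-class on which $A,B$ differ; $A<_rB$ iff $\gamma(A,B)\in F_{r-1}^+(n)$. For $X\in F_r^-(n)$, $\sigma_r(X)$ replaces each element of $X$ by the other element of its $\equiv_{r-1}$-class; $A\equiv_rB$ iff $A=B$, $A=\sigma_r(B)$ or $B=\sigma_r(A)$. The minimum $\min_{\prec_{r-1}}$ is taken with respect to $\prec_{r-1}$. -}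

module Defs where

open import Data.Bool using (Bool; true; false; _∧_; _∨_; not; if_then_else_)
open import Data.Nat using (ℕ; zero; suc; _+_; _*_; _∸_; _<ᵇ_; _≡ᵇ_)
open import Data.Product using (_×_; _,_)
open import Data.List using (List; []; _∷_; map; applyUpTo; filterᵇ; foldl; concatMap; length)
open import Data.Bool.ListAction using (any; all)
open import Relation.Nullary using (does)
open import Relation.Binary.Definitions using (DecidableEquality)
import Data.Nat.Properties as ℕP
import Data.Bool.Properties as BP
import Data.Product.Properties as PP
import Data.List.Properties as LP

-- the list element minimal w.r.t. a Bool-valued strict order (first one on ties);
-- the default is only returned for the empty list
minBy : {A : Set} → (A → A → Bool) → A → List A → A
minBy lt d []       = d
minBy lt d (x ∷ xs) = foldl (λ m y → if lt y m then y else m) x xs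

firstOr : {A : Set} → A → (A → Bool) → List A → A
firstOr d p []       = d
firstOr d p (x ∷ xs) = if p x then x else firstOr d p xs

countB : {A : Set} → (A → Bool) → List A → ℕ
countB p []       = 0
countB p (x ∷ xs) = (if p x then 1 else 0) + countB p xs

indexOf : {A : Set} → (A → A → Bool) → A → List A → ℕ
indexOf eq a []       = 0
indexOf eq a (x ∷ xs) = if eq a x then 0 else suc (indexOf eq a xs)

nth : List Bool → ℕ → Bool
nth []       _       = false
nth (b ∷ bs) zero    = b
nth (b ∷ bs) (suc i) = nth bs i

-- all Bool lists of a given length (= all subsets of a list of that length)
allBools : ℕ → List (List Bool)
allBools zero    = [] ∷ []
allBools (suc m) = concatMap (λ xs → (false ∷ xs) ∷ (true ∷ xs) ∷ []) (allBools m)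

-- Level 1: F₁(n) = {-,+}

data Sign : Set where
  minus plus : Sign

-- A "level" F_r(n), r ≥ 2: a finite carrier enumerated by `enum`
-- (the set F_r(n) itself), with <_r, F_r^-, F_r^+ and ≡_r as Bool relations.

record Level : Set₁ where
  field
    El      : Set
    _≟_     : DecidableEquality El
    def     : El            -- junk default, used only for empty folds
    enum    : List El       -- the elements of F_r(n), without repetition
    lt      : El → El → Bool
    isMinus : El → Bool
    isPlus  : El → Bool
    equiv   : El → El → Bool

  eqb : El → El → Bool
  eqb x y = does (x ≟ y)

  rep : El → El
  rep x = if isMinus x then x else firstOr x (λ y → isMinus y ∧ equiv x y) enum

  prec : El → El → Bool
  prec x y = lt (rep x) (rep y)

  minPrec : El → El → El
  minPrec x y = if prec y x then y else x

  other : El → El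
  other x = firstOr x (λ y → not (eqb y x) ∧ equiv x y) enum

  minElt : El
  minElt = minBy lt def enum

  maxElt : El
  maxElt = minBy (λ x y → lt y x) def enum

open Level public

module _ (n : ℕ) where
  private
    eq2 : ℕ × ℕ → ℕ × ℕ → Bool
    eq2 x y = does (PP.≡-dec ℕP._≟_ ℕP._≟_ x y)

  F2minus : List (ℕ × ℕ)
  F2minus = applyUpTo (λ j → (2 * n ∸ j , suc j)) n

  F2plus : List (ℕ × ℕ)
  F2plus = applyUpTo (λ j → (suc j , 2 * n ∸ j)) n

  -- F_2(n) in <_2-order: (2n,1) < (2n-1,2) < ... < (1,2n)
  level2 : Level
  level2 = record
    { El      = ℕ × ℕ
    ; _≟_     = PP.≡-dec ℕP._≟_ ℕP._≟_
    ; def     = (2 * n , 1)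
    ; enum    = applyUpTo (λ j → (2 * n ∸ j , suc j)) (2 * n)
    ; lt      = λ { (a , b) (c , d) → c <ᵇ a }
    ; isMinus = λ x → any (eq2 x) F2minus
    ; isPlus  = λ x → any (eq2 x) F2plus
    ; equiv   = λ x y → eq2 x y
                 ∨ any (λ j → (eq2 x (2 * n ∸ j , suc j) ∧ eq2 y (suc j , 2 * n ∸ j))
                            ∨ (eq2 y (2 * n ∸ j , suc j) ∧ eq2 x (suc j , 2 * n ∸ j)))
                       (applyUpTo (λ j → j) n)
    }

γ₂ : ℕ × ℕ → ℕ × ℕ → Sign
γ₂ (a₁ , _) (b₁ , _) = if a₁ <ᵇ b₁ then minus else plus

-- Level r+1 from level r (r ≥ 2). A subset X ⊆ F_r(n) is represented by
-- its characteristic Bool list w.r.t. the enumeration `enum` of F_r(n).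

module Next (L : Level) where
  mem : List Bool → El L → Bool
  mem X a = nth X (indexOf (eqb L) a (enum L))

  valid : List Bool → Bool
  valid X = all (λ a → countB (λ b → equiv L a b ∧ mem X b) (enum L) ≡ᵇ 1) (enum L)

  -- γ(A,B): the element of B ∩ E for the ≺_r-first ≡_r-class E on which A,B differ.
  -- (A,B contain one element per class, so B ∩ E = {b} with b ∈ B, b ∉ A.)
  γ : List Bool → List Bool → El L
  γ A B = minBy (prec L) (def L) (filterᵇ (λ b → mem B b ∧ not (mem A b)) (enum L))

  -- σ(X) = { other a | a ∈ X },  i.e.  b ∈ σ(X) iff other b ∈ X
  σ : List Bool → List Bool
  σ X = map (λ b → mem X (other L b)) (enum L)

  eqL : List Bool → List Bool → Bool
  eqL X Y = does (LP.≡-dec BP._≟_ X Y)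

  isMinus' : List Bool → Bool
  isMinus' X = mem X (minElt L)

  next : Level
  next = record
    { El      = List Bool
    ; _≟_     = LP.≡-dec BP._≟_
    ; def     = []
    ; enum    = filterᵇ valid (allBools (length (enum L)))
    ; lt      = λ A B → isPlus L (γ A B)
    ; isMinus = isMinus'
    ; isPlus  = λ X → mem X (maxElt L)
    ; equiv   = λ A B → eqL A B ∨ (isMinus' B ∧ eqL A (σ B)) ∨ (isMinus' A ∧ eqL B (σ A))
    }

-- lev n k  is the level F_{k+2}(n)
lev : ℕ → ℕ → Level
lev n zero    = level2 n
lev n (suc k) = Next.next (lev n k)

-- γ on F_{k+3}(n), with values in F_{k+2}(n)
γ : (n k : ℕ) → List Bool → List Bool → El (lev n k)
γ n k = Next.γ (lev n k)

module Submission where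

-- For r = 2, γ takes values in the two-element set {-,+}; the claim follows
-- from F₁ having two elements and from transitivity of < on ℕ.
--
-- For r ≥ 3 the argument is uniform in the level.  We isolate an invariant
-- `GoodLevel L` of a level: its enumeration has no repetitions, the ≡-classes
-- are pairs {a , twin a} with exactly one element in F⁻, F⁺ is the complement
-- of F⁻, <_r is a strict total order, and max = twin min.  Over a good level L
-- every element X of the next level contains exactly one of a , twin a, and
-- γ(X,Y) is characterised as the unique g ∈ Y ∖ X such that X and Y agree on
-- every b ≺ g (`γ-spec`, `separates-unique`).  Lemma 3.2 at level L follows
-- from this characterisation (`γ-distinct-classes`, `γ-same-class`); read
-- through the sign of γ it also makes <_{r+1} a strict total order, so the
-- next level is good again (`next-good`).  Level 2 is good by arithmetic on
-- its explicit enumeration (`level2-good`), so every level is good by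
-- induction (`lev-good`) and the theorem is the lemma at level F_{r-1}(n).

open import Defs
open import Data.Bool using (Bool; true; false; _∧_; _∨_; not; if_then_else_; T)
open import Data.Bool.Properties using (T-≡; not-involutive; ∧-inverseʳ; ∧-identityʳ)
  renaming (_≟_ to _≟ᵇ_)
open import Data.Bool.ListAction using (any; all)
open import Data.Empty using (⊥; ⊥-elim)
open import Data.List using (List; []; _∷_; map; length; filterᵇ; foldl; concatMap; applyUpTo)
open import Data.List.Properties using (length-map; filter-none)
open import Data.List.Membership.Propositional using (_∈_; find; lose)
open import Data.List.Membership.Propositional.Properties
  using (∈-filter⁺; ∈-filter⁻; ∈-applyUpTo⁺; ∈-applyUpTo⁻; ∈-++⁺ˡ)
open import Data.List.Relation.Unary.All as All using (All; []; _∷_)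
open import Data.List.Relation.Unary.All.Properties using (all⁺; all⁻; ¬All⇒Any¬)
open import Data.List.Relation.Unary.Any using (here; there)
open import Data.List.Relation.Unary.Any.Properties using (any⁺; any⁻)
open import Data.List.Relation.Unary.AllPairs using ([]; _∷_)
open import Data.List.Relation.Unary.Unique.Propositional using (Unique)
open import Data.List.Relation.Unary.Unique.Propositional.Properties using (filter⁺; applyUpTo⁺₁)
open import Data.Nat using (ℕ; zero; suc; _+_; _*_; _∸_; _≤_; _<_; _<ᵇ_; _≡ᵇ_; z≤n; s≤s; _≤?_; _<?_)
open import Data.Nat.Properties
  using ( +-suc; suc-injective; +-identityʳ; <ᵇ⇒<; <⇒<ᵇ; n≮n; <-trans; <-cmp; <⇒≤; ≤-trans; ≤-reflexive
        ; ≰⇒>; ≮⇒≥; m≤m+n; +-mono-≤; +-mono-≤-<; m∸n+n≡m; m+n∸n≡m; m∸[m∸n]≡n; +-∸-assoc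
        ; ∸-monoʳ-<; ∸-monoʳ-≤; ∸-cancelˡ-≡; m<n⇒0<n∸m; <⇒≢; even≢odd; <-irrefl; <-≤-trans; ≤-<-trans )
open import Data.Product using (_×_; _,_; ∃; proj₁; proj₂; swap)
open import Data.Sum using (_⊎_; inj₁; inj₂; [_,_]; [_,_]′)
open import Function using (_∘_; Equivalence)
open import Relation.Binary.Definitions using (DecidableEquality; tri<; tri≈; tri>)
open import Relation.Binary.PropositionalEquality
  using (_≡_; _≢_; refl; sym; trans; cong; cong₂; subst)
open import Relation.Nullary using (¬_; yes; no; does)
open import Relation.Nullary.Decidable using (T?; dec-true; dec-false)

clash : ∀ {b} → b ≡ true → b ≡ false → ⊥
clash refl ()

T⇒≡ : ∀ {b} → T b → b ≡ true
T⇒≡ = Equivalence.to T-≡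

≡⇒T : ∀ {b} → b ≡ true → T b
≡⇒T = Equivalence.from T-≡

∧-trueˡ : ∀ {a b} → a ∧ b ≡ true → a ≡ true
∧-trueˡ {true} _ = refl

∧-trueʳ : ∀ {a b} → a ∧ b ≡ true → b ≡ true
∧-trueʳ {true} p = p

∧-true : ∀ {a b} → a ≡ true → b ≡ true → a ∧ b ≡ true
∧-true refl q = q

∨-trueˡ : ∀ {a b} → a ≡ true → a ∨ b ≡ true
∨-trueˡ refl = refl

∨-trueʳ : ∀ {a b} → b ≡ true → a ∨ b ≡ true
∨-trueʳ {true} _ = refl
∨-trueʳ {false} q = q

∨-true-cases : ∀ {a b} → a ∨ b ≡ true → a ≡ true ⊎ b ≡ true
∨-true-cases {true} _ = inj₁ refl
∨-true-cases {false} q = inj₂ q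

if-true : ∀ {A : Set} {b} {x y : A} → b ≡ true → (if b then x else y) ≡ x
if-true refl = refl

if-false : ∀ {A : Set} {b} {x y : A} → b ≡ false → (if b then x else y) ≡ y
if-false refl = refl

flip-not : ∀ {b c} → b ≡ not c → not b ≡ c
flip-not {b} {c} e = trans (cong not e) (not-involutive c)

module _ {A : Set} (f : A → Bool) where

  all-true : (xs : List A) → all f xs ≡ true → ∀ {x} → x ∈ xs → f x ≡ true
  all-true xs e m = T⇒≡ (All.lookup (all⁺ f xs (≡⇒T e)) m)

  true-all : (xs : List A) → (∀ {x} → x ∈ xs → f x ≡ true) → all f xs ≡ true
  true-all xs h = T⇒≡ (all⁻ f (All.tabulate (≡⇒T ∘ h)))

  any-true : (xs : List A) → any f xs ≡ true → ∃ λ x → x ∈ xs × f x ≡ true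
  any-true xs e with find (any⁻ f xs (≡⇒T e))
  ... | x , m , fx = x , m , T⇒≡ fx

  true-any : {xs : List A} {x : A} → x ∈ xs → f x ≡ true → any f xs ≡ true
  true-any m e = T⇒≡ (any⁺ f (lose m (≡⇒T e)))

  ∈-filterᵇ⁺ : {xs : List A} {x : A} → x ∈ xs → f x ≡ true → x ∈ filterᵇ f xs
  ∈-filterᵇ⁺ m e = ∈-filter⁺ (T? ∘ f) m (≡⇒T e)

  ∈-filterᵇ⁻ : {xs : List A} {x : A} → x ∈ filterᵇ f xs → x ∈ xs × f x ≡ true
  ∈-filterᵇ⁻ m with ∈-filter⁻ (T? ∘ f) m
  ... | x∈xs , fx = x∈xs , T⇒≡ fx

  filterᵇ-none : (xs : List A) → (∀ x → f x ≡ false) → filterᵇ f xs ≡ []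
  filterᵇ-none xs h = filter-none (T? ∘ f) {xs = xs} (All.tabulate λ {x} _ fx → clash (T⇒≡ fx) (h x))

firstOr-unique : {A : Set} (d : A) (p : A → Bool) (xs : List A) {w : A} → w ∈ xs → p w ≡ true →
  (∀ {y} → y ∈ xs → p y ≡ true → y ≡ w) → firstOr d p xs ≡ w
firstOr-unique d p (x ∷ xs) {w} m pw h with p x in px
... | true = h (here refl) px
firstOr-unique d p (x ∷ xs) {w} (here refl) pw h | false = ⊥-elim (clash pw px)
firstOr-unique d p (x ∷ xs) {w} (there m) pw h | false = firstOr-unique d p xs m pw (h ∘ there)

module CharacteristicLists {A : Set} (_≟_ : DecidableEquality A) where

  _==_ : A → A → Bool
  x == y = does (x ≟ y)

  ==-sound : ∀ {x y} → x == y ≡ true → x ≡ y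
  ==-sound {x} {y} p with x ≟ y
  ... | yes x≡y = x≡y
  ... | no _ = ⊥-elim (clash p refl)

  ==-false : ∀ {x y} → x == y ≡ false → x ≢ y
  ==-false {x} {y} p with x ≟ y
  ... | yes _ = ⊥-elim (clash refl p)
  ... | no x≢y = x≢y

  ==-refl : ∀ x → x == x ≡ true
  ==-refl x = dec-true (x ≟ x) refl

  ==-of-≡ : ∀ {x y} → x ≡ y → x == y ≡ true
  ==-of-≡ {x} refl = ==-refl x

  ==-≢ : ∀ {x y} → x ≢ y → x == y ≡ false
  ==-≢ {x} {y} = dec-false (x ≟ y)

  memOf : List A → List Bool → A → Bool
  memOf xs X a = nth X (indexOf _==_ a xs)

  memOf-map : (xs : List A) (f : A → Bool) {b : A} → b ∈ xs → memOf xs (map f xs) b ≡ f b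
  memOf-map (x ∷ xs) f {b} m with b == x in e
  ... | true = cong f (sym (==-sound e))
  memOf-map (x ∷ xs) f {b} (here b≡x) | false = ⊥-elim (==-false e b≡x)
  memOf-map (x ∷ xs) f {b} (there m) | false = memOf-map xs f m

  memOf-head : (xs : List A) (x : A) (b : Bool) (X : List Bool) → memOf (x ∷ xs) (b ∷ X) x ≡ b
  memOf-head xs x b X rewrite ==-refl x = refl

  memOf-tail : (xs : List A) (x a : A) (b : Bool) (X : List Bool) → a ≢ x →
    memOf (x ∷ xs) (b ∷ X) a ≡ memOf xs X a
  memOf-tail xs x a b X a≢x rewrite ==-≢ a≢x = refl

  memOf-ext : (xs : List A) → Unique xs → (X Y : List Bool) →
    length X ≡ length xs → length Y ≡ length xs →
    (∀ {a} → a ∈ xs → memOf xs X a ≡ memOf xs Y a) → X ≡ Y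
  memOf-ext [] _ [] [] _ _ _ = refl
  memOf-ext (x ∷ xs) (x∉xs ∷ u) (b ∷ X) (c ∷ Y) lX lY agree = cong₂ _∷_ heads tails
    where
    heads : b ≡ c
    heads = trans (sym (memOf-head xs x b X)) (trans (agree (here refl)) (memOf-head xs x c Y))
    ≢x : ∀ {a} → a ∈ xs → a ≢ x
    ≢x m a≡x = All.lookup x∉xs m (sym a≡x)
    tails : X ≡ Y
    tails = memOf-ext xs u X Y (suc-injective lX) (suc-injective lY) λ {a} m →
      trans (sym (memOf-tail xs x a b X (≢x m))) (trans (agree (there m)) (memOf-tail xs x a c Y (≢x m)))

  indicator : Bool → ℕ
  indicator b = if b then 1 else 0

  count-none : (p : A → Bool) (xs : List A) → (∀ {y} → y ∈ xs → p y ≡ false) → countB p xs ≡ 0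
  count-none p [] h = refl
  count-none p (x ∷ xs) h rewrite h (here refl) = count-none p xs (h ∘ there)

  count-one : (p : A → Bool) (xs : List A) → Unique xs → {u : A} → u ∈ xs →
    (∀ {y} → y ∈ xs → p y ≡ true → y ≡ u) → countB p xs ≡ indicator (p u)
  count-one p (x ∷ xs) (x∉xs ∷ _) (here refl) h =
    trans (cong (indicator (p x) +_) (count-none p xs false-on-xs)) (+-identityʳ _)
    where
    false-on-xs : ∀ {y} → y ∈ xs → p y ≡ false
    false-on-xs {y} m with p y in e
    ... | true = ⊥-elim (All.lookup x∉xs m (sym (h (there m) e)))
    ... | false = refl
  count-one p (x ∷ xs) (x∉xs ∷ u) (there m) h with p x in e
  ... | true = ⊥-elim (All.lookup x∉xs m (h (here refl) e))
  ... | false = count-one p xs u m (h ∘ there)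

  count-split : (p q : A → Bool) (xs : List A) →
    countB p xs ≡ countB (λ y → p y ∧ q y) xs + countB (λ y → p y ∧ not (q y)) xs
  count-split p q [] = refl
  count-split p q (x ∷ xs) with p x | q x
  ... | true | true = cong suc (count-split p q xs)
  ... | true | false = trans (cong suc (count-split p q xs)) (sym (+-suc _ _))
  ... | false | _ = count-split p q xs

  count-two : (p : A → Bool) (xs : List A) → Unique xs → {u v : A} → u ∈ xs → v ∈ xs → u ≢ v →
    (∀ {y} → y ∈ xs → p y ≡ true → y ≡ u ⊎ y ≡ v) →
    countB p xs ≡ indicator (p u) + indicator (p v)
  count-two p xs uniq {u} {v} u∈ v∈ u≢v only = trans (count-split p (_== u) xs) (cong₂ _+_ at-u at-v)
    where
    at-u : countB (λ y → p y ∧ (y == u)) xs ≡ indicator (p u)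
    at-u = trans (count-one _ xs uniq u∈ (λ _ e → ==-sound (∧-trueʳ {p _} e)))
                 (cong indicator (trans (cong (p u ∧_) (==-refl u)) (∧-identityʳ (p u))))
    is-v : ∀ {y} → y ∈ xs → p y ∧ not (y == u) ≡ true → y ≡ v
    is-v {y} m e with only m (∧-trueˡ e)
    ... | inj₁ refl = ⊥-elim (clash (∧-trueʳ {p y} e) (cong not (==-refl y)))
    ... | inj₂ y≡v = y≡v
    at-v : countB (λ y → p y ∧ not (y == u)) xs ≡ indicator (p v)
    at-v = trans (count-one _ xs uniq v∈ is-v)
                 (cong indicator (trans (cong (λ b → p v ∧ not b) (==-≢ (u≢v ∘ sym)))
                                        (∧-identityʳ (p v))))

module Minimum {A : Set} (_≟_ : DecidableEquality A) (R : A → A → Bool) (P : A → Set)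
  (R-trans : ∀ {x y z} → P x → P y → P z → R x y ≡ true → R y z ≡ true → R x z ≡ true)
  (R-total : ∀ {x y} → P x → P y → x ≢ y → R x y ≡ true ⊎ R y x ≡ true) where

  _⊑_ : A → A → Set
  x ⊑ y = x ≡ y ⊎ R x y ≡ true

  ⊑-trans : ∀ {x y z} → P x → P y → P z → x ⊑ y → y ⊑ z → x ⊑ z
  ⊑-trans _ _ _ (inj₁ refl) y⊑z = y⊑z
  ⊑-trans _ _ _ (inj₂ x<y) (inj₁ refl) = inj₂ x<y
  ⊑-trans px py pz (inj₂ x<y) (inj₂ y<z) = inj₂ (R-trans px py pz x<y y<z)

  step : A → A → A
  step m y = if R y m then y else m

  step-∈ : ∀ m y → step m y ∈ m ∷ y ∷ []
  step-∈ m y with R y m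
  ... | true = there (here refl)
  ... | false = here refl

  step-⊑ : ∀ {m y} → P m → P y → step m y ⊑ m × step m y ⊑ y
  step-⊑ {m} {y} pm py with R y m in e
  ... | true = inj₂ e , inj₁ refl
  ... | false with m ≟ y
  ...   | yes m≡y = inj₁ refl , inj₁ m≡y
  ...   | no m≢y = inj₁ refl , [ inj₂ , (λ y<m → ⊥-elim (clash y<m e)) ] (R-total pm py m≢y)

  fold-min : (m : A) (ys : List A) → All P (m ∷ ys) →
    foldl step m ys ∈ m ∷ ys × All (foldl step m ys ⊑_) (m ∷ ys)
  fold-min m [] _ = here refl , inj₁ refl ∷ []
  fold-min m (y ∷ ys) (pm ∷ py ∷ pys) with fold-min (step m y) ys (Ps ∷ pys)
    where Ps = All.lookup (pm ∷ py ∷ []) (step-∈ m y)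
  ... | r∈ , r⊑s ∷ below = widen r∈ , ⊑-trans Pr Ps pm r⊑s s⊑m ∷ ⊑-trans Pr Ps py r⊑s s⊑y ∷ below
    where
    s = step m y
    Ps = All.lookup (pm ∷ py ∷ []) (step-∈ m y)
    Pr = All.lookup (Ps ∷ pys) r∈
    s⊑m = proj₁ (step-⊑ pm py)
    s⊑y = proj₂ (step-⊑ pm py)
    widen : ∀ {z} → z ∈ s ∷ ys → z ∈ m ∷ y ∷ ys
    widen (here refl) = ∈-++⁺ˡ (step-∈ m y)
    widen (there k) = there (there k)

  minBy-min : (d : A) (xs : List A) {w : A} → w ∈ xs → All P xs →
    minBy R d xs ∈ xs × (∀ {y} → y ∈ xs → y ≢ minBy R d xs → R (minBy R d xs) y ≡ true)
  minBy-min d (x ∷ xs) _ pxs with fold-min x xs pxs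
  ... | r∈ , below = r∈ , λ m y≢r → [ (λ r≡y → ⊥-elim (y≢r (sym r≡y))) , (λ r<y → r<y) ] (All.lookup below m)

  minBy-unique : (R-asym : ∀ {x y} → P x → P y → R x y ≡ true → R y x ≡ true → ⊥)
    (d : A) (xs : List A) {w : A} → w ∈ xs → All P xs →
    (∀ {y} → y ∈ xs → y ≢ w → R w y ≡ true) → minBy R d xs ≡ w
  minBy-unique R-asym d xs {w} w∈ pxs least with minBy-min d xs w∈ pxs
  ... | m∈ , minimal with minBy R d xs ≟ w
  ...   | yes m≡w = m≡w
  ...   | no m≢w = ⊥-elim (R-asym (All.lookup pxs m∈) (All.lookup pxs w∈)
                             (minimal w∈ (m≢w ∘ sym)) (least m∈ m≢w))

consBoth : List Bool → List (List Bool)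
consBoth xs = (false ∷ xs) ∷ (true ∷ xs) ∷ []

∈-consBoth⁻ : (zs : List (List Bool)) {X : List Bool} → X ∈ concatMap consBoth zs →
  ∃ λ Z → Z ∈ zs × ∃ λ b → X ≡ b ∷ Z
∈-consBoth⁻ (Z ∷ zs) (here refl) = Z , here refl , false , refl
∈-consBoth⁻ (Z ∷ zs) (there (here refl)) = Z , here refl , true , refl
∈-consBoth⁻ (Z ∷ zs) (there (there m)) with ∈-consBoth⁻ zs m
... | W , W∈ , b , refl = W , there W∈ , b , refl

∈-consBoth⁺ : (zs : List (List Bool)) {Z : List Bool} (b : Bool) → Z ∈ zs → (b ∷ Z) ∈ concatMap consBoth zs
∈-consBoth⁺ (Z ∷ zs) false (here refl) = here refl
∈-consBoth⁺ (Z ∷ zs) true (here refl) = there (here refl)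
∈-consBoth⁺ (Z ∷ zs) b (there m) = there (there (∈-consBoth⁺ zs b m))

allBools-length : (m : ℕ) {X : List Bool} → X ∈ allBools m → length X ≡ m
allBools-length zero (here refl) = refl
allBools-length (suc m) X∈ with ∈-consBoth⁻ (allBools m) X∈
... | Z , Z∈ , b , refl = cong suc (allBools-length m Z∈)

allBools-complete : (X : List Bool) → X ∈ allBools (length X)
allBools-complete [] = here refl
allBools-complete (b ∷ X) = ∈-consBoth⁺ (allBools (length X)) b (allBools-complete X)

consBoth-unique : (zs : List (List Bool)) → Unique zs → Unique (concatMap consBoth zs)
consBoth-unique [] _ = []
consBoth-unique (Z ∷ zs) (Z∉zs ∷ u) = ((λ ()) ∷ fresh false) ∷ fresh true ∷ consBoth-unique zs u
  where
  fresh : (b : Bool) → All ((b ∷ Z) ≢_) (concatMap consBoth zs)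
  fresh b = All.tabulate λ m → go (∈-consBoth⁻ zs m)
    where
    go : ∀ {X} → (∃ λ W → W ∈ zs × ∃ λ b' → X ≡ b' ∷ W) → (b ∷ Z) ≢ X
    go (W , W∈ , _ , refl) refl = All.lookup Z∉zs W∈ refl

allBools-unique : (m : ℕ) → Unique (allBools m)
allBools-unique zero = [] ∷ []
allBools-unique (suc m) = consBoth-unique (allBools m) (allBools-unique m)

record GoodLevel (L : Level) : Set where
  field
    enum-unique    : Unique (enum L)
    twin           : El L → El L
    twin-∈         : ∀ {a} → a ∈ enum L → twin a ∈ enum L
    twin-≢         : ∀ {a} → a ∈ enum L → twin a ≢ a
    twin-twin      : ∀ {a} → a ∈ enum L → twin (twin a) ≡ a
    equiv-refl     : ∀ {a} → a ∈ enum L → equiv L a a ≡ true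
    equiv-twin     : ∀ {a} → a ∈ enum L → equiv L a (twin a) ≡ true
    equiv-inv      : ∀ {a b} → a ∈ enum L → b ∈ enum L → equiv L a b ≡ true → b ≡ a ⊎ b ≡ twin a
    plus-not-minus : ∀ {a} → a ∈ enum L → isPlus L a ≡ not (isMinus L a)
    minus-twin     : ∀ {a} → a ∈ enum L → isMinus L (twin a) ≡ not (isMinus L a)
    lt-irrefl      : ∀ {a} → a ∈ enum L → lt L a a ≡ false
    lt-trans       : ∀ {a b d} → a ∈ enum L → b ∈ enum L → d ∈ enum L →
                     lt L a b ≡ true → lt L b d ≡ true → lt L a d ≡ true
    lt-total       : ∀ {a b} → a ∈ enum L → b ∈ enum L → a ≢ b → lt L a b ≡ true ⊎ lt L b a ≡ true
    min-∈          : minElt L ∈ enum L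
    max-twin       : twin (minElt L) ≡ maxElt L
    def-not-plus   : isPlus L (def L) ≡ false

module GoodLevelFacts (L : Level) (G : GoodLevel L) where
  open GoodLevel G public
  open CharacteristicLists (_≟_ L) public

  E : List (El L)
  E = enum L

  other≡twin : ∀ {a} → a ∈ E → other L a ≡ twin a
  other≡twin {a} a∈ = firstOr-unique a _ E (twin-∈ a∈) twin-ok only-twin
    where
    twin-ok : not (twin a == a) ∧ equiv L a (twin a) ≡ true
    twin-ok rewrite ==-≢ (twin-≢ a∈) = equiv-twin a∈
    only-twin : ∀ {y} → y ∈ E → not (y == a) ∧ equiv L a y ≡ true → y ≡ twin a
    only-twin {y} y∈ e with equiv-inv a∈ y∈ (∧-trueʳ {not (y == a)} e)
    ... | inj₁ refl = ⊥-elim (clash (∧-trueˡ e) (cong not (==-refl y)))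
    ... | inj₂ y≡twin = y≡twin

  plus-twin : ∀ {a} → a ∈ E → isPlus L (twin a) ≡ isMinus L a
  plus-twin a∈ = trans (plus-not-minus (twin-∈ a∈)) (flip-not (minus-twin a∈))

  rep-minus : ∀ {a} → isMinus L a ≡ true → rep L a ≡ a
  rep-minus = if-true

  rep-plus : ∀ {a} → a ∈ E → isMinus L a ≡ false → rep L a ≡ twin a
  rep-plus {a} a∈ e rewrite e = firstOr-unique a _ E (twin-∈ a∈) twin-ok only-twin
    where
    twin-ok : isMinus L (twin a) ∧ equiv L a (twin a) ≡ true
    twin-ok rewrite minus-twin a∈ | e = equiv-twin a∈
    only-twin : ∀ {y} → y ∈ E → isMinus L y ∧ equiv L a y ≡ true → y ≡ twin a
    only-twin {y} y∈ q with equiv-inv a∈ y∈ (∧-trueʳ {isMinus L y} q)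
    ... | inj₁ refl = ⊥-elim (clash (∧-trueˡ q) e)
    ... | inj₂ y≡twin = y≡twin

  rep-cases : ∀ {a} → a ∈ E → rep L a ≡ a ⊎ rep L a ≡ twin a
  rep-cases {a} a∈ = by-sign (isMinus L a) refl
    where
    by-sign : ∀ b → isMinus L a ≡ b → rep L a ≡ a ⊎ rep L a ≡ twin a
    by-sign true e = inj₁ (rep-minus e)
    by-sign false e = inj₂ (rep-plus a∈ e)

  rep-twin : ∀ {a} → a ∈ E → rep L (twin a) ≡ rep L a
  rep-twin {a} a∈ = by-sign (isMinus L a) refl
    where
    by-sign : ∀ b → isMinus L a ≡ b → rep L (twin a) ≡ rep L a
    by-sign true e = trans (rep-plus (twin-∈ a∈) (trans (minus-twin a∈) (cong not e)))
                           (trans (twin-twin a∈) (sym (rep-minus e)))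
    by-sign false e = trans (rep-minus (trans (minus-twin a∈) (cong not e))) (sym (rep-plus a∈ e))

  rep-∈ : ∀ {a} → a ∈ E → rep L a ∈ E
  rep-∈ {a} a∈ = [ (λ e → subst (_∈ E) (sym e) a∈) , (λ e → subst (_∈ E) (sym e) (twin-∈ a∈)) ] (rep-cases a∈)

  rep-injective : ∀ {a b} → a ∈ E → b ∈ E → rep L a ≡ rep L b → b ≡ a ⊎ b ≡ twin a
  rep-injective {a} {b} a∈ b∈ e with rep-cases a∈ | rep-cases b∈
  ... | inj₁ p | inj₁ q = inj₁ (trans (sym q) (trans (sym e) p))
  ... | inj₁ p | inj₂ q = inj₂ (trans (sym (twin-twin b∈)) (cong twin (trans (sym q) (trans (sym e) p))))
  ... | inj₂ p | inj₁ q = inj₂ (trans (sym q) (trans (sym e) p))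
  ... | inj₂ p | inj₂ q = inj₁ (trans (sym (twin-twin b∈)) (trans (cong twin (trans (sym q) (trans (sym e) p))) (twin-twin a∈)))

  lt-asym : ∀ {a b} → a ∈ E → b ∈ E → lt L a b ≡ true → lt L b a ≡ true → ⊥
  lt-asym a∈ b∈ p q = clash (lt-trans a∈ b∈ a∈ p q) (lt-irrefl a∈)

  prec-twinˡ : ∀ {x y} → x ∈ E → prec L (twin x) y ≡ prec L x y
  prec-twinˡ {x} {y} x∈ = cong (λ z → lt L z (rep L y)) (rep-twin x∈)

  prec-twinʳ : ∀ {x y} → y ∈ E → prec L x (twin y) ≡ prec L x y
  prec-twinʳ {x} {y} y∈ = cong (lt L (rep L x)) (rep-twin y∈)

  prec-irrefl : ∀ {x} → x ∈ E → prec L x x ≡ false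
  prec-irrefl x∈ = lt-irrefl (rep-∈ x∈)

  prec-trans : ∀ {x y z} → x ∈ E → y ∈ E → z ∈ E → prec L x y ≡ true → prec L y z ≡ true → prec L x z ≡ true
  prec-trans x∈ y∈ z∈ = lt-trans (rep-∈ x∈) (rep-∈ y∈) (rep-∈ z∈)

  prec-asym : ∀ {x y} → x ∈ E → y ∈ E → prec L x y ≡ true → prec L y x ≡ true → ⊥
  prec-asym x∈ y∈ = lt-asym (rep-∈ x∈) (rep-∈ y∈)

  prec-asym-false : ∀ {x y} → x ∈ E → y ∈ E → prec L x y ≡ true → prec L y x ≡ false
  prec-asym-false {x} {y} x∈ y∈ p with prec L y x in q
  ... | true = ⊥-elim (prec-asym x∈ y∈ p q)
  ... | false = refl

  prec-total : ∀ {x y} → x ∈ E → y ∈ E → y ≢ x → y ≢ twin x → prec L x y ≡ true ⊎ prec L y x ≡ true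
  prec-total x∈ y∈ y≢x y≢twin = lt-total (rep-∈ x∈) (rep-∈ y∈) λ e → [ y≢x , y≢twin ] (rep-injective x∈ y∈ e)

  prec⇒≢ : ∀ {x y} → x ∈ E → prec L x y ≡ true → y ≢ x
  prec⇒≢ x∈ p refl = clash p (prec-irrefl x∈)

  prec⇒≢twin : ∀ {x y} → x ∈ E → prec L x y ≡ true → y ≢ twin x
  prec⇒≢twin x∈ p refl = clash (trans (sym (prec-twinʳ x∈)) p) (prec-irrefl x∈)

module NextLevel (L : Level) (G : GoodLevel L) where
  open GoodLevelFacts L G
  open Next L using (mem; valid; σ; isMinus'; next) renaming (γ to γ⁺)

  E⁺ : List (List Bool)
  E⁺ = enum next

  class-count : ∀ {a} (X : List Bool) → a ∈ E →
    countB (λ b → equiv L a b ∧ mem X b) E ≡ indicator (mem X a) + indicator (mem X (twin a))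
  class-count {a} X a∈ =
    trans (count-two _ E enum-unique a∈ (twin-∈ a∈) (twin-≢ a∈ ∘ sym) (λ y∈ q → equiv-inv a∈ y∈ (∧-trueˡ q)))
          (cong₂ (λ u v → indicator (u ∧ mem X a) + indicator (v ∧ mem X (twin a))) (equiv-refl a∈) (equiv-twin a∈))

  exactly-one : ∀ x y → (indicator x + indicator y ≡ᵇ 1) ≡ true → y ≡ not x
  exactly-one true false _ = refl
  exactly-one false true _ = refl

  one-of-two : ∀ x y → y ≡ not x → (indicator x + indicator y ≡ᵇ 1) ≡ true
  one-of-two true .false refl = refl
  one-of-two false .true refl = refl

  valid⇒complementary : ∀ {X a} → valid X ≡ true → a ∈ E → mem X (twin a) ≡ not (mem X a)
  valid⇒complementary {X} {a} v a∈ =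
    exactly-one _ _ (subst (λ k → (k ≡ᵇ 1) ≡ true) (class-count X a∈) (all-true _ E v a∈))

  complementary⇒valid : ∀ {X} → (∀ {a} → a ∈ E → mem X (twin a) ≡ not (mem X a)) → valid X ≡ true
  complementary⇒valid {X} h =
    true-all _ E λ {a} a∈ → subst (λ k → (k ≡ᵇ 1) ≡ true) (sym (class-count X a∈)) (one-of-two _ _ (h a∈))

  ∈E⁺⁻ : ∀ {X} → X ∈ E⁺ → length X ≡ length E × valid X ≡ true
  ∈E⁺⁻ X∈ with ∈-filterᵇ⁻ valid X∈
  ... | X∈all , v = allBools-length _ X∈all , v

  ∈E⁺⁺ : ∀ {X} → length X ≡ length E → valid X ≡ true → X ∈ E⁺
  ∈E⁺⁺ {X} l v = ∈-filterᵇ⁺ valid (subst (λ k → X ∈ allBools k) l (allBools-complete X)) v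

  twin-mem : ∀ {X a} → X ∈ E⁺ → a ∈ E → mem X (twin a) ≡ not (mem X a)
  twin-mem {X} X∈ = valid⇒complementary {X} (proj₂ (∈E⁺⁻ X∈))

  twin-in : ∀ {X a} → X ∈ E⁺ → a ∈ E → mem X a ≡ false → mem X (twin a) ≡ true
  twin-in X∈ a∈ e = trans (twin-mem X∈ a∈) (cong not e)

  twin-out : ∀ {X a} → X ∈ E⁺ → a ∈ E → mem X a ≡ true → mem X (twin a) ≡ false
  twin-out X∈ a∈ e = trans (twin-mem X∈ a∈) (cong not e)

  mem-σ : ∀ X {b} → b ∈ E → mem (σ X) b ≡ mem X (twin b)
  mem-σ X b∈ = trans (memOf-map E (λ b → mem X (other L b)) b∈) (cong (mem X) (other≡twin b∈))

  σ-length : ∀ X → length (σ X) ≡ length E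
  σ-length X = length-map _ E

  σ-∈ : ∀ {X} → X ∈ E⁺ → σ X ∈ E⁺
  σ-∈ {X} X∈ = ∈E⁺⁺ (σ-length X) (complementary⇒valid {σ X} λ {a} a∈ →
    trans (mem-σ X (twin-∈ a∈)) (trans (cong (mem X) (twin-twin a∈))
      (sym (flip-not (trans (mem-σ X a∈) (twin-mem X∈ a∈))))))

  σ-σ : ∀ {X} → X ∈ E⁺ → σ (σ X) ≡ X
  σ-σ {X} X∈ = memOf-ext E enum-unique (σ (σ X)) X (σ-length (σ X)) (proj₁ (∈E⁺⁻ X∈)) λ a∈ →
    trans (mem-σ (σ X) a∈) (trans (mem-σ X (twin-∈ a∈)) (cong (mem X) (twin-twin a∈)))

  σ-minus : ∀ {X} → X ∈ E⁺ → isMinus' (σ X) ≡ not (isMinus' X)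
  σ-minus {X} X∈ = trans (mem-σ X min-∈) (twin-mem X∈ min-∈)

  σ-≢ : ∀ {X} → X ∈ E⁺ → σ X ≢ X
  σ-≢ {X} X∈ e = b≢not (trans (cong isMinus' (sym e)) (σ-minus X∈))
    where
    b≢not : ∀ {b} → b ≡ not b → ⊥
    b≢not {true} ()
    b≢not {false} ()

  diff : List Bool → List Bool → List (El L)
  diff X Y = filterᵇ (λ b → mem Y b ∧ not (mem X b)) E

  InDiff : List Bool → List Bool → El L → Set
  InDiff X Y b = b ∈ E × mem Y b ≡ true × mem X b ≡ false

  diff⁻ : ∀ {X Y b} → b ∈ diff X Y → InDiff X Y b
  diff⁻ {X} {Y} {b} b∈ with ∈-filterᵇ⁻ _ b∈
  ... | b∈E , q = b∈E , ∧-trueˡ q , not-true (∧-trueʳ {mem Y b} q)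
    where
    not-true : ∀ {x} → not x ≡ true → x ≡ false
    not-true {false} _ = refl

  diff⁺ : ∀ {X Y b} → InDiff X Y b → b ∈ diff X Y
  diff⁺ {X} {Y} (b∈ , inY , inX) = ∈-filterᵇ⁺ _ b∈ (∧-true inY (cong not inX))

  diff-twin : ∀ {X Y b} → X ∈ E⁺ → Y ∈ E⁺ → b ∈ E → mem X b ≡ true → mem Y b ≡ false → InDiff X Y (twin b)
  diff-twin X∈ Y∈ b∈ inX outY = twin-∈ b∈ , twin-in Y∈ b∈ outY , twin-out X∈ b∈ inX

  diff-nonempty : ∀ {X Y} → X ∈ E⁺ → Y ∈ E⁺ → X ≢ Y → ∃ λ w → InDiff X Y w
  diff-nonempty {X} {Y} X∈ Y∈ X≢Y with find (¬All⇒Any¬ (λ a → mem X a ≟ᵇ mem Y a) E not-all-agree)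
    where
    not-all-agree : ¬ All (λ a → mem X a ≡ mem Y a) E
    not-all-agree agree = X≢Y (memOf-ext E enum-unique X Y (proj₁ (∈E⁺⁻ X∈)) (proj₁ (∈E⁺⁻ Y∈)) (All.lookup agree))
  ... | a , a∈ , disagree = by-values (mem X a) (mem Y a) refl refl disagree
    where
    by-values : ∀ u v → mem X a ≡ u → mem Y a ≡ v → u ≢ v → ∃ λ w → InDiff X Y w
    by-values false true inX inY _ = a , a∈ , inY , inX
    by-values true false inX inY _ = twin a , diff-twin X∈ Y∈ a∈ inX inY
    by-values true true _ _ u≢v = ⊥-elim (u≢v refl)
    by-values false false _ _ u≢v = ⊥-elim (u≢v refl)

  record Separates (X Y : List Bool) (g : El L) : Set where
    field
      g-∈   : g ∈ E
      in-Y  : mem Y g ≡ true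
      out-X : mem X g ≡ false
      agree : ∀ {b} → b ∈ E → prec L b g ≡ true → mem X b ≡ mem Y b
  open Separates

  γ-spec : ∀ {X Y} → X ∈ E⁺ → Y ∈ E⁺ → X ≢ Y → Separates X Y (γ⁺ X Y)
  γ-spec {X} {Y} X∈ Y∈ X≢Y with diff-nonempty X∈ Y∈ X≢Y
  ... | w , w-in with Minimum.minBy-min (_≟_ L) (prec L) (InDiff X Y)
                        (λ p q r → prec-trans (proj₁ p) (proj₁ q) (proj₁ r)) diff-total
                        (def L) (diff X Y) (diff⁺ {X} {Y} w-in) (All.tabulate (diff⁻ {X} {Y}))
    where
    diff-total : ∀ {x y} → InDiff X Y x → InDiff X Y y → x ≢ y → prec L x y ≡ true ⊎ prec L y x ≡ true
    diff-total (x∈ , x-in , _) (y∈ , y-in , _) x≢y =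
      prec-total x∈ y∈ (x≢y ∘ sym) (λ { refl → clash y-in (twin-out Y∈ x∈ x-in) })
  ... | g∈diff , minimal = record { g-∈ = g∈ ; in-Y = in-Y' ; out-X = out-X' ; agree = agree' }
    where
    g = γ⁺ X Y
    g∈ = proj₁ (diff⁻ {X} {Y} g∈diff)
    in-Y' = proj₁ (proj₂ (diff⁻ {X} {Y} g∈diff))
    out-X' = proj₂ (proj₂ (diff⁻ {X} {Y} g∈diff))
    agree' : ∀ {b} → b ∈ E → prec L b g ≡ true → mem X b ≡ mem Y b
    agree' {b} b∈ b≺g = by-values (mem X b) (mem Y b) refl refl
      where
      by-values : ∀ u v → mem X b ≡ u → mem Y b ≡ v → u ≡ v
      by-values true true _ _ = refl
      by-values false false _ _ = refl
      by-values false true inX inY =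
        ⊥-elim (prec-asym b∈ g∈ b≺g (minimal (diff⁺ {X} {Y} (b∈ , inY , inX)) (prec⇒≢ b∈ b≺g ∘ sym)))
      by-values true false inX inY =
        ⊥-elim (prec-asym b∈ g∈ b≺g (trans (sym (prec-twinʳ b∈))
          (minimal (diff⁺ {X} {Y} (diff-twin X∈ Y∈ b∈ inX inY)) (prec⇒≢twin b∈ b≺g ∘ sym))))

  separates-unique : ∀ {X Y g h} → Y ∈ E⁺ → Separates X Y g → Separates X Y h → h ≡ g
  separates-unique {X} {Y} {g} {h} Y∈ sg sh with _≟_ L h g
  ... | yes h≡g = h≡g
  ... | no h≢g with _≟_ L h (twin g)
  ...   | yes refl = ⊥-elim (clash (in-Y sh) (twin-out Y∈ (g-∈ sg) (in-Y sg)))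
  ...   | no h≢twin with prec-total (g-∈ sg) (g-∈ sh) h≢g h≢twin
  ...     | inj₁ g≺h = ⊥-elim (clash (in-Y sg) (trans (sym (agree sh (g-∈ sg) g≺h)) (out-X sg)))
  ...     | inj₂ h≺g = ⊥-elim (clash (in-Y sh) (trans (sym (agree sg (g-∈ sh) h≺g)) (out-X sh)))

  γ-unique : ∀ {X Y h} → X ∈ E⁺ → Y ∈ E⁺ → X ≢ Y → Separates X Y h → γ⁺ X Y ≡ h
  γ-unique X∈ Y∈ X≢Y sh = separates-unique Y∈ sh (γ-spec X∈ Y∈ X≢Y)

  γ-swap : ∀ {X Y} → X ∈ E⁺ → Y ∈ E⁺ → X ≢ Y → γ⁺ Y X ≡ twin (γ⁺ X Y)
  γ-swap {X} {Y} X∈ Y∈ X≢Y = γ-unique Y∈ X∈ (X≢Y ∘ sym) record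
    { g-∈ = twin-∈ g∈
    ; in-Y = twin-in X∈ g∈ (out-X s)
    ; out-X = twin-out Y∈ g∈ (in-Y s)
    ; agree = λ b∈ b≺twin → sym (agree s b∈ (trans (sym (prec-twinʳ g∈)) b≺twin))
    }
    where
    s = γ-spec X∈ Y∈ X≢Y
    g∈ = g-∈ s

  -- γ(B,C) can lie in the class of γ(A,B) only as its twin, as γ(A,B) ∈ B ∌ γ(B,C)
  same-class : ∀ {A B C} → A ∈ E⁺ → B ∈ E⁺ → C ∈ E⁺ → A ≢ B → B ≢ C →
    equiv L (γ⁺ A B) (γ⁺ B C) ≡ true → γ⁺ B C ≡ twin (γ⁺ A B)
  same-class {A} {B} {C} A∈ B∈ C∈ A≢B B≢C e =
    [ (λ same → ⊥-elim (clash (in-Y s₁) (trans (cong (mem B) (sym same)) (out-X s₂)))) , (λ twin≡ → twin≡) ]′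
    (equiv-inv (g-∈ s₁) (g-∈ s₂) e)
    where
    s₁ = γ-spec A∈ B∈ A≢B
    s₂ = γ-spec B∈ C∈ B≢C

  module _ {A B C} (A∈ : A ∈ E⁺) (B∈ : B ∈ E⁺) (C∈ : C ∈ E⁺) (A≢B : A ≢ B) (B≢C : B ≢ C) (A≢C : A ≢ C) where
    private
      s₁ = γ-spec A∈ B∈ A≢B
      s₂ = γ-spec B∈ C∈ B≢C
      s₃ = γ-spec A∈ C∈ A≢C
      g₁ = γ⁺ A B
      g₂ = γ⁺ B C
      g₃ = γ⁺ A C
      g₁∈ = g-∈ s₁
      g₂∈ = g-∈ s₂
      g₃∈ = g-∈ s₃

    -- if γ(A,B) ≺ γ(B,C), then γ(A,B) also separates A from C
    γ-left : prec L g₁ g₂ ≡ true → g₃ ≡ g₁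
    γ-left g₁≺g₂ = γ-unique A∈ C∈ A≢C record
      { g-∈ = g₁∈
      ; in-Y = trans (sym (agree s₂ g₁∈ g₁≺g₂)) (in-Y s₁)
      ; out-X = out-X s₁
      ; agree = λ b∈ b≺g₁ → trans (agree s₁ b∈ b≺g₁) (agree s₂ b∈ (prec-trans b∈ g₁∈ g₂∈ b≺g₁ g₁≺g₂))
      }

    -- if γ(B,C) ≺ γ(A,B), then γ(B,C) also separates A from C
    γ-right : prec L g₂ g₁ ≡ true → g₃ ≡ g₂
    γ-right g₂≺g₁ = γ-unique A∈ C∈ A≢C record
      { g-∈ = g₂∈
      ; in-Y = in-Y s₂
      ; out-X = trans (agree s₁ g₂∈ g₂≺g₁) (out-X s₂)
      ; agree = λ b∈ b≺g₂ → trans (agree s₁ b∈ (prec-trans b∈ g₂∈ g₁∈ b≺g₂ g₂≺g₁)) (agree s₂ b∈ b≺g₂)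
      }

    γ-distinct-classes : equiv L g₁ g₂ ≡ false → g₃ ≡ minPrec L g₁ g₂
    γ-distinct-classes e with prec-total g₁∈ g₂∈ (λ q → clash (trans (cong (equiv L g₁) q) (equiv-refl g₁∈)) e)
                                                  (λ q → clash (trans (cong (equiv L g₁) q) (equiv-twin g₁∈)) e)
    ... | inj₁ g₁≺g₂ = trans (γ-left g₁≺g₂) (sym (if-false (prec-asym-false g₁∈ g₂∈ g₁≺g₂)))
    ... | inj₂ g₂≺g₁ = trans (γ-right g₂≺g₁) (sym (if-true g₂≺g₁))

    γ-same-class : equiv L g₁ g₂ ≡ true → prec L g₁ g₃ ≡ true × prec L g₂ g₃ ≡ true
    γ-same-class e = g₁≺g₃ , trans (cong (λ z → prec L z g₃) g₂≡twin) (trans (prec-twinˡ g₁∈) g₁≺g₃)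
      where
      g₂≡twin : g₂ ≡ twin g₁
      g₂≡twin = same-class A∈ B∈ C∈ A≢B B≢C e
      -- C contains g₂ = twin g₁, hence not g₁
      g₁-out-C : mem C g₁ ≡ false
      g₁-out-C = subst (λ z → mem C z ≡ false) (twin-twin g₁∈)
                   (twin-out C∈ (twin-∈ g₁∈) (subst (λ z → mem C z ≡ true) g₂≡twin (in-Y s₂)))
      g₁≺g₃ : prec L g₁ g₃ ≡ true
      g₁≺g₃ with _≟_ L g₃ g₁
      ... | yes g₃≡g₁ = ⊥-elim (clash (in-Y s₃) (trans (cong (mem C) g₃≡g₁) g₁-out-C))
      ... | no g₃≢g₁ with _≟_ L g₃ (twin g₁)
      ...   | yes g₃≡twin = ⊥-elim (clash (trans (cong (mem A) g₃≡twin) (twin-in A∈ g₁∈ (out-X s₁))) (out-X s₃))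
      ...   | no g₃≢twin with prec-total g₁∈ g₃∈ g₃≢g₁ g₃≢twin
      ...     | inj₁ g₁≺g₃ = g₁≺g₃
      ...     | inj₂ g₃≺g₁ = ⊥-elim (clash (in-Y s₃)
                  (trans (sym (agree s₂ g₃∈ g₃≺g₂)) (trans (sym (agree s₁ g₃∈ g₃≺g₁)) (out-X s₃))))
        where
        g₃≺g₂ : prec L g₃ g₂ ≡ true
        g₃≺g₂ = trans (cong (prec L g₃) g₂≡twin) (trans (prec-twinʳ g₁∈) g₃≺g₁)

  lt⁺-irrefl : ∀ {A} → lt next A A ≡ false
  lt⁺-irrefl {A} = trans (cong (λ xs → isPlus L (minBy (prec L) (def L) xs))
                               (filterᵇ-none _ E (λ x → ∧-inverseʳ (mem A x))))
                         def-not-plus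

  lt⁺⇒≢ : ∀ {A B} → lt next A B ≡ true → A ≢ B
  lt⁺⇒≢ {A} p refl = clash p (lt⁺-irrefl {A})

  lt⁺-flip : ∀ {A B} → A ∈ E⁺ → B ∈ E⁺ → A ≢ B → lt next B A ≡ not (lt next A B)
  lt⁺-flip A∈ B∈ A≢B =
    trans (cong (isPlus L) (γ-swap A∈ B∈ A≢B)) (trans (plus-twin g∈) (sym (flip-not (plus-not-minus g∈))))
    where g∈ = g-∈ (γ-spec A∈ B∈ A≢B)

  lt⁺-total : ∀ {A B} → A ∈ E⁺ → B ∈ E⁺ → A ≢ B → lt next A B ≡ true ⊎ lt next B A ≡ true
  lt⁺-total {A} {B} A∈ B∈ A≢B with lt next A B in e
  ... | true = inj₁ refl
  ... | false = inj₂ (trans (lt⁺-flip A∈ B∈ A≢B) (cong not e))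

  -- transitivity is Lemma 3.2 read through the sign of γ
  lt⁺-trans : ∀ {A B C} → A ∈ E⁺ → B ∈ E⁺ → C ∈ E⁺ → lt next A B ≡ true → lt next B C ≡ true → lt next A C ≡ true
  lt⁺-trans {A} {B} {C} A∈ B∈ C∈ A<B B<C with _≟_ next A C
  ... | yes refl = ⊥-elim (clash B<C (trans (lt⁺-flip A∈ B∈ (lt⁺⇒≢ A<B)) (cong not A<B)))
  ... | no A≢C = by-class (equiv L (γ⁺ A B) (γ⁺ B C)) refl
    where
    A≢B = lt⁺⇒≢ A<B
    B≢C = lt⁺⇒≢ B<C
    minPrec-plus : ∀ b → isPlus L (if b then γ⁺ B C else γ⁺ A B) ≡ true
    minPrec-plus true = B<C
    minPrec-plus false = A<B
    by-class : ∀ b → equiv L (γ⁺ A B) (γ⁺ B C) ≡ b → lt next A C ≡ true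
    by-class false e = trans (cong (isPlus L) (γ-distinct-classes A∈ B∈ C∈ A≢B B≢C A≢C e))
                             (minPrec-plus (prec L (γ⁺ B C) (γ⁺ A B)))
    by-class true e = ⊥-elim (clash B<C (trans (cong (isPlus L) (same-class A∈ B∈ C∈ A≢B B≢C e))
                        (trans (plus-twin g∈) (trans (sym (flip-not (plus-not-minus g∈))) (cong not A<B)))))
      where g∈ = g-∈ (γ-spec A∈ B∈ A≢B)

  lt⁺-asym : ∀ {A B} → A ∈ E⁺ → B ∈ E⁺ → lt next A B ≡ true → lt next B A ≡ true → ⊥
  lt⁺-asym {A} A∈ B∈ p q = clash (lt⁺-trans A∈ B∈ A∈ p q) (lt⁺-irrefl {A})

  -- the minimum of the next level is F⁻ itself, and its maximum is σ F⁻ = F⁺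
  allMinus : List Bool
  allMinus = map (isMinus L) E

  mem-allMinus : ∀ {b} → b ∈ E → mem allMinus b ≡ isMinus L b
  mem-allMinus = memOf-map E (isMinus L)

  allMinus-∈ : allMinus ∈ E⁺
  allMinus-∈ = ∈E⁺⁺ (length-map _ E) (complementary⇒valid {allMinus} λ a∈ →
    trans (mem-allMinus (twin-∈ a∈)) (trans (minus-twin a∈) (cong not (sym (mem-allMinus a∈)))))

  -- γ(F⁻, B) ∉ F⁻ lies in F⁺
  allMinus-least : ∀ {B} → B ∈ E⁺ → B ≢ allMinus → lt next allMinus B ≡ true
  allMinus-least B∈ B≢ = trans (plus-not-minus g∈) (cong not (trans (sym (mem-allMinus g∈)) (out-X s)))
    where
    s = γ-spec allMinus-∈ B∈ (B≢ ∘ sym)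
    g∈ = g-∈ s

  -- γ(B, σ F⁻) ∈ σ F⁻, i.e. its twin is in F⁻, so it lies in F⁺
  allPlus-greatest : ∀ {B} → B ∈ E⁺ → B ≢ σ allMinus → lt next B (σ allMinus) ≡ true
  allPlus-greatest B∈ B≢ =
    trans (plus-not-minus g∈) (trans (sym (minus-twin g∈))
      (trans (sym (mem-allMinus (twin-∈ g∈))) (trans (sym (mem-σ allMinus g∈)) (in-Y s))))
    where
    s = γ-spec B∈ (σ-∈ allMinus-∈) B≢
    g∈ = g-∈ s

  minElt-next : minElt next ≡ allMinus
  minElt-next = Minimum.minBy-unique (_≟_ next) (lt next) (_∈ E⁺) lt⁺-trans lt⁺-total lt⁺-asym
    [] E⁺ allMinus-∈ (All.tabulate (λ X∈ → X∈)) (λ B∈ B≢ → allMinus-least B∈ B≢)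

  maxElt-next : maxElt next ≡ σ allMinus
  maxElt-next = Minimum.minBy-unique (_≟_ next) (λ X Y → lt next Y X) (_∈ E⁺)
    (λ X∈ Y∈ Z∈ p q → lt⁺-trans Z∈ Y∈ X∈ q p) (λ X∈ Y∈ X≢Y → lt⁺-total Y∈ X∈ (X≢Y ∘ sym))
    (λ X∈ Y∈ p q → lt⁺-asym X∈ Y∈ q p)
    [] E⁺ (σ-∈ allMinus-∈) (All.tabulate (λ X∈ → X∈)) (λ B∈ B≢ → allPlus-greatest B∈ B≢)

  module Eq⁺ = CharacteristicLists (_≟_ next)

  equiv⁺-twin : ∀ {A} → A ∈ E⁺ → equiv next A (σ A) ≡ true
  equiv⁺-twin {A} A∈ = by-sign (isMinus' A) refl
    where
    by-sign : ∀ b → isMinus' A ≡ b → equiv next A (σ A) ≡ true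
    by-sign true e = ∨-trueʳ {A Eq⁺.== σ A} (∨-trueʳ {isMinus' (σ A) ∧ (A Eq⁺.== σ (σ A))}
                       (∧-true e (Eq⁺.==-refl (σ A))))
    by-sign false e = ∨-trueʳ {A Eq⁺.== σ A} (∨-trueˡ (∧-true (trans (σ-minus A∈) (cong not e))
                                               (trans (cong (A Eq⁺.==_) (σ-σ A∈)) (Eq⁺.==-refl A))))

  equiv⁺-inv : ∀ {A B} → B ∈ E⁺ → equiv next A B ≡ true → B ≡ A ⊎ B ≡ σ A
  equiv⁺-inv {A} {B} B∈ e with ∨-true-cases {A Eq⁺.== B} e
  ... | inj₁ q = inj₁ (sym (Eq⁺.==-sound {A} {B} q))
  ... | inj₂ q with ∨-true-cases {isMinus' B ∧ (A Eq⁺.== σ B)} q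
  ...   | inj₁ r = inj₂ (trans (sym (σ-σ B∈)) (cong σ (sym (Eq⁺.==-sound {A} {σ B} (∧-trueʳ {isMinus' B} r)))))
  ...   | inj₂ r = inj₂ (Eq⁺.==-sound {B} {σ A} (∧-trueʳ {isMinus' A} r))

  next-good : GoodLevel next
  next-good = record
    { enum-unique    = filter⁺ (T? ∘ valid) (allBools-unique (length E))
    ; twin           = σ
    ; twin-∈         = σ-∈
    ; twin-≢         = σ-≢
    ; twin-twin      = σ-σ
    ; equiv-refl     = λ {A} _ → ∨-trueˡ (Eq⁺.==-refl A)
    ; equiv-twin     = equiv⁺-twin
    ; equiv-inv      = λ {A} _ B∈ → equiv⁺-inv {A} B∈
    ; plus-not-minus = λ {A} A∈ → trans (cong (mem A) (sym max-twin)) (twin-mem A∈ min-∈)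
    ; minus-twin     = σ-minus
    ; lt-irrefl      = λ {A} _ → lt⁺-irrefl {A}
    ; lt-trans       = lt⁺-trans
    ; lt-total       = lt⁺-total
    ; min-∈          = subst (_∈ E⁺) (sym minElt-next) allMinus-∈
    ; max-twin       = trans (cong σ minElt-next) (sym maxElt-next)
    ; def-not-plus   = refl
    }

<ᵇ-true : ∀ {a b} → a < b → (a <ᵇ b) ≡ true
<ᵇ-true p = T⇒≡ (<⇒<ᵇ p)

<ᵇ-sound : ∀ {a b} → (a <ᵇ b) ≡ true → a < b
<ᵇ-sound {a} {b} e = <ᵇ⇒< a b (≡⇒T e)

<ᵇ-false : ∀ {a b} → (a <ᵇ b) ≡ false → b ≤ a
<ᵇ-false e = ≮⇒≥ (λ a<b → clash (<ᵇ-true a<b) e)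

<ᵇ-irrefl : ∀ a → (a <ᵇ a) ≡ false
<ᵇ-irrefl a with a <ᵇ a in e
... | true = ⊥-elim (n≮n a (<ᵇ-sound e))
... | false = refl

-- Level 2 is good.  Its j-th element in <₂-order is f j = (2n-j , j+1),
-- j < 2n; the twin of (a , b) is (b , a), which is f (2n-1-j).
module Level2 (n : ℕ) (n≥1 : 1 ≤ n) where
  L : Level
  L = level2 n

  open CharacteristicLists (_≟_ L)

  M : ℕ
  M = 2 * n

  M≡n+n : M ≡ n + n
  M≡n+n = cong (n +_) (+-identityʳ n)

  f : ℕ → ℕ × ℕ
  f j = (M ∸ j , suc j)

  E : List (ℕ × ℕ)
  E = enum L

  ∈E⁻ : ∀ {a} → a ∈ E → ∃ λ j → j < M × a ≡ f j
  ∈E⁻ = ∈-applyUpTo⁻ f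

  f-∈ : ∀ {j} → j < M → f j ∈ E
  f-∈ = ∈-applyUpTo⁺ f

  f-injective : ∀ {i j} → f i ≡ f j → i ≡ j
  f-injective refl = refl

  mirror : ℕ → ℕ
  mirror j = M ∸ suc j

  swap-f : ∀ {j} → j < M → swap (f j) ≡ f (mirror j)
  swap-f j<M = cong₂ _,_ (sym (m∸[m∸n]≡n j<M)) (+-∸-assoc 1 j<M)

  mirror-< : ∀ {j} → j < M → mirror j < M
  mirror-< j<M = ∸-monoʳ-< {M} (s≤s z≤n) j<M

  mirror-upper : ∀ {j} → n ≤ j → j < M → mirror j < n
  mirror-upper {j} n≤j j<M with n ≤? mirror j
  ... | no n≰ = ≰⇒> n≰
  ... | yes n≤ = ⊥-elim (n≮n (n + n) (≤-trans (≤-reflexive (sym (+-suc n n)))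
                   (≤-trans (+-mono-≤ n≤ (s≤s n≤j)) (≤-reflexive (trans (m∸n+n≡m j<M) M≡n+n)))))

  mirror-lower : ∀ {j} → j < n → n ≤ mirror j
  mirror-lower j<n = ≤-trans (≤-reflexive (sym (trans (cong (_∸ n) M≡n+n) (m+n∸n≡m n n)))) (∸-monoʳ-≤ M j<n)

  plus-index : ∀ {i j} → i < n → suc j ≡ M ∸ i → n ≤ j
  plus-index {i} {j} i<n e with n ≤? j
  ... | yes n≤j = n≤j
  ... | no n≰j = ⊥-elim (n≮n M (subst (_< M) (trans (cong (_+ i) e) (m∸n+n≡m i≤M))
                   (subst (suc j + i <_) (sym M≡n+n) (+-mono-≤-< (≰⇒> n≰j) i<n))))
    where
    i≤M : i ≤ M
    i≤M = ≤-trans (<⇒≤ i<n) (subst (n ≤_) (sym M≡n+n) (m≤m+n n n))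

  -- no element of F₂(n) is its own twin: 2n ≠ 2j+1
  f-not-twin : ∀ {j} → j < M → suc j ≢ M ∸ j
  f-not-twin {j} j<M e = even≢odd n j (trans (sym (m∸n+n≡m (<⇒≤ j<M)))
    (trans (cong (_+ j) (sym e)) (cong suc (cong (j +_) (sym (+-identityʳ j))))))

  E-unique : Unique E
  E-unique = applyUpTo⁺₁ f M (λ i<j _ e → <⇒≢ i<j (f-injective e))

  twin-∈ : ∀ {a} → a ∈ E → swap a ∈ E
  twin-∈ a∈ with ∈E⁻ a∈
  ... | j , j<M , refl = subst (_∈ E) (sym (swap-f j<M)) (f-∈ (mirror-< j<M))

  twin-≢ : ∀ {a} → a ∈ E → swap a ≢ a
  twin-≢ a∈ e with ∈E⁻ a∈
  ... | j , j<M , refl = f-not-twin j<M (cong proj₁ e)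

  -- (2n-j , j+1) ≡₂ (j+1 , 2n-j) is witnessed at index j or at its mirror
  equiv-twin : ∀ {a} → a ∈ E → equiv L a (swap a) ≡ true
  equiv-twin a∈ with ∈E⁻ a∈
  ... | j , j<M , refl with j <? n
  ...   | yes j<n = ∨-trueʳ (true-any _ (∈-applyUpTo⁺ (λ i → i) j<n)
                      (∨-trueˡ (∧-true (==-refl (f j)) (==-refl (swap (f j))))))
  ...   | no j≮n = ∨-trueʳ (true-any _ (∈-applyUpTo⁺ (λ i → i) (mirror-upper (≮⇒≥ j≮n) j<M))
                      (∨-trueʳ (∧-true (==-of-≡ (swap-f j<M)) (==-of-≡ (cong swap (swap-f j<M))))))

  equiv-inv : ∀ {a b} → equiv L a b ≡ true → b ≡ a ⊎ b ≡ swap a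
  equiv-inv {a} {b} e with ∨-true-cases {a == b} e
  ... | inj₁ q = inj₁ (sym (==-sound q))
  ... | inj₂ q with any-true _ (applyUpTo (λ i → i) n) q
  ...   | i , _ , r with ∨-true-cases {(a == f i) ∧ (b == swap (f i))} r
  ...     | inj₁ s = inj₂ (trans (==-sound (∧-trueʳ {a == f i} s)) (cong swap (sym (==-sound (∧-trueˡ s)))))
  ...     | inj₂ s = inj₂ (trans (==-sound (∧-trueˡ s)) (cong swap (sym (==-sound (∧-trueʳ {b == f i} s)))))

  minus-lower : ∀ {j} → j < n → isMinus L (f j) ≡ true
  minus-lower {j} j<n = true-any _ (∈-applyUpTo⁺ f j<n) (==-refl (f j))

  minus-upper : ∀ {j} → n ≤ j → isMinus L (f j) ≡ false
  minus-upper {j} n≤j with isMinus L (f j) in e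
  ... | false = refl
  ... | true with any-true _ (applyUpTo f n) e
  ...   | y , y∈ , q with ∈-applyUpTo⁻ f y∈
  ...     | i , i<n , refl = ⊥-elim (n≮n n (≤-<-trans n≤j (subst (_< n) (sym (f-injective (==-sound q))) i<n)))

  plus-upper : ∀ {j} → n ≤ j → j < M → isPlus L (f j) ≡ true
  plus-upper {j} n≤j j<M = true-any _ (∈-applyUpTo⁺ (λ i → (suc i , M ∸ i)) (mirror-upper n≤j j<M))
                             (==-of-≡ (cong swap (swap-f j<M)))

  plus-lower : ∀ {j} → j < n → isPlus L (f j) ≡ false
  plus-lower {j} j<n with isPlus L (f j) in e
  ... | false = refl
  ... | true with any-true _ (applyUpTo (λ i → (suc i , M ∸ i)) n) e
  ...   | y , y∈ , q with ∈-applyUpTo⁻ (λ i → (suc i , M ∸ i)) y∈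
  ...     | i , i<n , refl =
          ⊥-elim (n≮n n (≤-<-trans (plus-index i<n (cong proj₂ (==-sound {f j} {(suc i , M ∸ i)} q))) j<n))

  plus-not-minus : ∀ {a} → a ∈ E → isPlus L a ≡ not (isMinus L a)
  plus-not-minus a∈ with ∈E⁻ a∈
  ... | j , j<M , refl with j <? n
  ...   | yes j<n = trans (plus-lower j<n) (cong not (sym (minus-lower j<n)))
  ...   | no j≮n = trans (plus-upper (≮⇒≥ j≮n) j<M) (cong not (sym (minus-upper (≮⇒≥ j≮n))))

  minus-twin : ∀ {a} → a ∈ E → isMinus L (swap a) ≡ not (isMinus L a)
  minus-twin a∈ with ∈E⁻ a∈
  ... | j , j<M , refl with j <? n
  ...   | yes j<n = trans (cong (isMinus L) (swap-f j<M))
                      (trans (minus-upper (mirror-lower j<n)) (cong not (sym (minus-lower j<n))))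
  ...   | no j≮n = trans (cong (isMinus L) (swap-f j<M))
                      (trans (minus-lower (mirror-upper (≮⇒≥ j≮n) j<M)) (cong not (sym (minus-upper (≮⇒≥ j≮n)))))

  lt-irrefl : ∀ {a} → lt L a a ≡ false
  lt-irrefl {a} = <ᵇ-irrefl (proj₁ a)

  lt-trans : ∀ {a b d} → lt L a b ≡ true → lt L b d ≡ true → lt L a d ≡ true
  lt-trans {a} {b} {d} p q = <ᵇ-true (<-trans (<ᵇ-sound {proj₁ d} {proj₁ b} q) (<ᵇ-sound {proj₁ b} {proj₁ a} p))

  lt-total : ∀ {a b} → a ∈ E → b ∈ E → a ≢ b → lt L a b ≡ true ⊎ lt L b a ≡ true
  lt-total a∈ b∈ a≢b with ∈E⁻ a∈ | ∈E⁻ b∈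
  ... | i , i<M , refl | j , j<M , refl with <-cmp (M ∸ i) (M ∸ j)
  ...   | tri< i> _ _ = inj₂ (<ᵇ-true i>)
  ...   | tri≈ _ same _ = ⊥-elim (a≢b (cong f (∸-cancelˡ-≡ (<⇒≤ i<M) (<⇒≤ j<M) same)))
  ...   | tri> _ _ j> = inj₁ (<ᵇ-true j>)

  lt-asym : ∀ {a b} → lt L a b ≡ true → lt L b a ≡ true → ⊥
  lt-asym {a} {b} p q = clash (lt-trans {a} {b} {a} p q) (lt-irrefl {a})

  0<M : 0 < M
  0<M = ≤-trans n≥1 (m≤m+n n _)

  minElt₂ : minElt L ≡ f 0
  minElt₂ = Minimum.minBy-unique (_≟_ L) (lt L) (_∈ E)
    (λ {x} {y} {z} _ _ _ → lt-trans {x} {y} {z}) lt-total (λ {x} {y} _ _ → lt-asym {x} {y})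
    (def L) E (f-∈ 0<M) (All.tabulate (λ a∈ → a∈)) f0-least
    where
    f0-least : ∀ {y} → y ∈ E → y ≢ f 0 → lt L (f 0) y ≡ true
    f0-least y∈ y≢ with ∈E⁻ y∈
    ... | zero , _ , refl = ⊥-elim (y≢ refl)
    ... | suc j , j<M , refl = <ᵇ-true (∸-monoʳ-< {M} {suc j} {0} (s≤s z≤n) (<⇒≤ j<M))

  maxElt₂ : maxElt L ≡ swap (f 0)
  maxElt₂ = Minimum.minBy-unique (_≟_ L) (λ x y → lt L y x) (_∈ E) (λ {x} {y} {z} _ _ _ p q → lt-trans {z} {y} {x} q p)
    (λ a∈ b∈ a≢b → lt-total b∈ a∈ (a≢b ∘ sym)) (λ {x} {y} _ _ p q → lt-asym {y} {x} p q)
    (def L) E (twin-∈ (f-∈ 0<M)) (All.tabulate (λ a∈ → a∈)) greatest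
    where
    two≤ : ∀ k → k ≢ 0 → k ≢ 1 → 1 < k
    two≤ zero k≢0 _ = ⊥-elim (k≢0 refl)
    two≤ (suc zero) _ k≢1 = ⊥-elim (k≢1 refl)
    two≤ (suc (suc k)) _ _ = s≤s (s≤s z≤n)
    greatest : ∀ {y} → y ∈ E → y ≢ swap (f 0) → lt L y (swap (f 0)) ≡ true
    greatest y∈ y≢ with ∈E⁻ y∈
    ... | j , j<M , refl = <ᵇ-true (two≤ (M ∸ j) (λ e → <⇒≢ (m<n⇒0<n∸m j<M) (sym e))
          (λ e → y≢ (cong₂ _,_ e (trans (sym (cong (_+ j) e)) (m∸n+n≡m (<⇒≤ j<M))))))

  level2-good : GoodLevel L
  level2-good = record
    { enum-unique    = E-unique
    ; twin           = swap
    ; twin-∈         = twin-∈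
    ; twin-≢         = twin-≢
    ; twin-twin      = λ _ → refl
    ; equiv-refl     = λ {a} _ → ∨-trueˡ (==-refl a)
    ; equiv-twin     = equiv-twin
    ; equiv-inv      = λ _ _ → equiv-inv
    ; plus-not-minus = plus-not-minus
    ; minus-twin     = minus-twin
    ; lt-irrefl      = λ {a} _ → lt-irrefl {a}
    ; lt-trans       = λ {a} {b} {d} _ _ _ → lt-trans {a} {b} {d}
    ; lt-total       = lt-total
    ; min-∈          = subst (_∈ E) (sym minElt₂) (f-∈ 0<M)
    ; max-twin       = trans (cong swap minElt₂) (sym maxElt₂)
    ; def-not-plus   = plus-lower {0} n≥1
    }

lev-good : (n : ℕ) → 1 ≤ n → (k : ℕ) → GoodLevel (lev n k)
lev-good n n≥1 zero = Level2.level2-good n n≥1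
lev-good n n≥1 (suc k) = NextLevel.next-good (lev n k) (lev-good n n≥1 k)

sign-dichotomy : (x y z : Sign) → y ≢ z → x ≡ y ⊎ x ≡ z
sign-dichotomy minus minus _ _ = inj₁ refl
sign-dichotomy plus plus _ _ = inj₁ refl
sign-dichotomy minus plus minus _ = inj₂ refl
sign-dichotomy plus minus plus _ = inj₂ refl
sign-dichotomy minus plus plus y≢z = ⊥-elim (y≢z refl)
sign-dichotomy plus minus minus y≢z = ⊥-elim (y≢z refl)

γ₂-transitive : (A B C : ℕ × ℕ) → γ₂ A B ≡ γ₂ B C → γ₂ A C ≡ γ₂ A B
γ₂-transitive (a , _) (b , _) (c , _) same with a <ᵇ b in ab | b <ᵇ c in bc
γ₂-transitive (a , _) (b , _) (c , _) () | true | false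
γ₂-transitive (a , _) (b , _) (c , _) () | false | true
... | true | true = cong (if_then minus else plus) (<ᵇ-true (<-trans (<ᵇ-sound {a} {b} ab) (<ᵇ-sound {b} {c} bc)))
... | false | false with a <ᵇ c in ac
...   | false = refl
...   | true = ⊥-elim (<-irrefl refl (<-≤-trans (<ᵇ-sound {a} {c} ac) (≤-trans (<ᵇ-false {b} {c} bc) (<ᵇ-false {a} {b} ab))))

lemma3p2 : (n : ℕ) → 1 ≤ n →
    ((A B C : ℕ × ℕ) →
        A ∈ enum (lev n 0) → B ∈ enum (lev n 0) → C ∈ enum (lev n 0) →
        A ≢ B → B ≢ C → A ≢ C →
        (γ₂ A B ≢ γ₂ B C → (γ₂ A C ≡ γ₂ A B ⊎ γ₂ A C ≡ γ₂ B C))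
        × (γ₂ A B ≡ γ₂ B C → (γ₂ A C ≡ γ₂ A B × γ₂ A B ≡ γ₂ B C)))
    × ((k : ℕ) (A B C : List Bool) →
        A ∈ enum (lev n (suc k)) → B ∈ enum (lev n (suc k)) → C ∈ enum (lev n (suc k)) →
        A ≢ B → B ≢ C → A ≢ C →
        (equiv (lev n k) (γ n k A B) (γ n k B C) ≡ false →
            γ n k A C ≡ minPrec (lev n k) (γ n k A B) (γ n k B C))
        × (equiv (lev n k) (γ n k A B) (γ n k B C) ≡ true →
            (prec (lev n k) (γ n k A B) (γ n k A C) ≡ true
             × prec (lev n k) (γ n k B C) (γ n k A C) ≡ true)))
lemma3p2 n n≥1 = level-two , higher-levels
  where
  level-two = λ A B C _ _ _ _ _ _ →
    sign-dichotomy (γ₂ A C) (γ₂ A B) (γ₂ B C) , λ same → γ₂-transitive A B C same , same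
  higher-levels = λ k A B C A∈ B∈ C∈ A≢B B≢C A≢C →
    let open NextLevel (lev n k) (lev-good n n≥1 k)
    in γ-distinct-classes A∈ B∈ C∈ A≢B B≢C A≢C , γ-same-class A∈ B∈ C∈ A≢B B≢C A≢C
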